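{- There is a positive constant $c$ such that for every finite (left) quasifield $Q$ with $q$ elements and every $A\subset Q$, \[ |A\cdot(A+A)| \geq c\min\left\{q, \frac{|A|^3}{q}\right\}. \] Furthermore, if $|A| \gg q^{2/3}$, then one may take $c = 1+o(1)$.
   Context: A (left) quasifield is a set $Q$ with two binary operations $+$ and $\cdot$ such that $(Q,+)$ is a group with identity $0$; $(Q\setminus\{0\},\cdot)$ is a loop (for all $a,b$ the equations $a\cdot x=b$ and $y\cdot a=b$ have unique solutions, and there is an identity $1$); $a\cdot(b+c)=a\cdot b+a\cdot c$ for all $a,b,c$; $0\cdot x=0$ for all $x$; and for $a\neq b$ the equation $a\cdot x=b\cdot x+c$ has exactly one solution $x$. For $A\subset Q$, $A+A=\{a+b:a,b\in A\}$ and $A\cdot(A+A)=\{a\cdot s: a\in A, s\in A+A\}$. The notation $f\gg g$ means $g=o(f)$ (as $q\to\infty$), and $o(1)$ denotes a quantity tending to $0$ as $q\to\infty$. -}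

module Defs where

open import Data.Nat using (ℕ; NonZero; _^_)
open import Data.Fin using (Fin; _≟_)
open import Data.Fin.Subset using (Subset; _∈_)
open import Data.Fin.Subset.Properties using (_∈?_)
open import Data.Fin.Properties using (any?)
open import Data.Vec using (tabulate)
open import Data.Product using (Σ; _×_; _,_)
open import Data.Integer using (+_)
open import Data.Rational using (ℚ; _/_; _⊓_)
open import Relation.Nullary using (¬_; does)
open import Relation.Nullary.Decidable using (_×-dec_)
open import Relation.Binary.PropositionalEquality using (_≡_)

∃!-syn : ∀ {n} → (Fin n → Set) → Set
∃!-syn {n} P = Σ (Fin n) λ x → P x × (∀ y → P y → y ≡ x)

record Quasifield (q : ℕ) : Set where
  infixl 6 _⊕_
  infixl 7 _⊙_
  field
    _⊕_ _⊙_ : Fin q → Fin q → Fin q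
    𝟘 𝟙 : Fin q
    ⊖_ : Fin q → Fin q
    ⊕-assoc : ∀ a b c → (a ⊕ b) ⊕ c ≡ a ⊕ (b ⊕ c)
    ⊕-identityˡ : ∀ a → 𝟘 ⊕ a ≡ a
    ⊕-identityʳ : ∀ a → a ⊕ 𝟘 ≡ a
    ⊕-inverseˡ : ∀ a → (⊖ a) ⊕ a ≡ 𝟘
    ⊕-inverseʳ : ∀ a → a ⊕ (⊖ a) ≡ 𝟘
    ⊙-closed : ∀ a b → ¬ a ≡ 𝟘 → ¬ b ≡ 𝟘 → ¬ (a ⊙ b) ≡ 𝟘
    𝟙≢𝟘 : ¬ 𝟙 ≡ 𝟘
    ⊙-identityˡ : ∀ a → ¬ a ≡ 𝟘 → 𝟙 ⊙ a ≡ a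
    ⊙-identityʳ : ∀ a → ¬ a ≡ 𝟘 → a ⊙ 𝟙 ≡ a
    ⊙-leftDiv : ∀ a b → ¬ a ≡ 𝟘 → ¬ b ≡ 𝟘 →
      ∃!-syn (λ x → ¬ x ≡ 𝟘 × a ⊙ x ≡ b)
    ⊙-rightDiv : ∀ a b → ¬ a ≡ 𝟘 → ¬ b ≡ 𝟘 →
      ∃!-syn (λ y → ¬ y ≡ 𝟘 × y ⊙ a ≡ b)
    distribˡ : ∀ a b c → a ⊙ (b ⊕ c) ≡ (a ⊙ b) ⊕ (a ⊙ c)
    zeroˡ : ∀ x → 𝟘 ⊙ x ≡ 𝟘
    planar : ∀ a b c → ¬ a ≡ b → ∃!-syn (λ x → a ⊙ x ≡ (b ⊙ x) ⊕ c)

module _ {q : ℕ} (Q : Quasifield q) where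
  open Quasifield Q

  sumSet : Subset q → Subset q
  sumSet A = tabulate λ s → does (any? λ a → any? λ b →
    (a ∈? A) ×-dec ((b ∈? A) ×-dec ((a ⊕ b) ≟ s)))

  prodSet : Subset q → Subset q → Subset q
  prodSet A S = tabulate λ x → does (any? λ a → any? λ s →
    (a ∈? A) ×-dec ((s ∈? S) ×-dec ((a ⊙ s) ≟ x)))

  prodSumSet : Subset q → Subset q
  prodSumSet A = prodSet A (sumSet A)

finNonZero : ∀ {q} → Fin q → NonZero q
finNonZero {ℕ.suc q} _ = _

minBound : ∀ {q} → Quasifield q → ℕ → ℚ
minBound {q} Q a =
  (+ q / 1) ⊓ ((+ (a ^ 3)) / q) {{finNonZero (Quasifield.𝟘 Q)}}

{-# OPTIONS --safe #-}
-- For a ∈ A ∖ {0} and c ∈ A the curves b ↦ a ⊙ (b ⊕ c) form a family of m = |A ∖ {0}| |A| graphs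
-- over Q, and by planarity two distinct ones meet at most once.  Hence the number g(p , b) of curves
-- through (b , p) satisfies Σ (q g − m)² ≤ q³ m.  Above every b ∈ A all curves pass through
-- P = A(A+A), so P × A carries |A| m incidences while its expected share is only |P| |A| m / q;
-- Cauchy–Schwarz on P × A turns this discrepancy into |A ∖ {0}| |A|² (q − |P|)² ≤ |P| q³.
-- Either |P| ≥ q / 2, or q − |P| ≥ q / 2 and then |A|³ ≤ 8 |P| q; and if |A|³ ≥ 2 d² q² the same
-- inequality gives q − |P| ≤ q / d.
module Submission where

open import Defs
open import Data.Nat using (ℕ; suc)
open import Data.Fin using (Fin)
open import Data.Fin.Subset using (Subset)
open import Relation.Nullary using (Dec)

module IntegerSums where

  open import Data.Nat using (zero; suc; z≤n)
  open import Data.Fin using (zero; suc; _≟_)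
  open import Data.Fin.Properties using (suc-injective)
  open import Data.Fin.Subset using (∣_∣; inside; outside)
  open import Data.Fin.Subset.Properties using (_∈?_)
  open import Data.Vec using (_∷_; [])
  open import Data.Integer using (ℤ; +_; +[1+_]; -_; -[1+_]; 0ℤ; 1ℤ; _+_; _*_; _-_; _≤_; +≤+; nonNegative)
  open import Data.Integer.Properties
    using (+-*-semiring; +-identityˡ; +-identityʳ; *-identityˡ; *-zeroʳ; *-comm; suc-*; pos-*;
           ≤-refl; ≤-reflexive; +-mono-≤; *-monoˡ-≤-nonNeg; *-cancelˡ-≤-pos; 0≤i-j⇒j≤i)
  open import Data.Integer.Tactic.RingSolver using (solve-∀)
  open import Data.Bool using (if_then_else_)
  open import Data.Product using (_×_; _,_)
  open import Relation.Nullary using (yes; no; ¬_; does)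
  open import Relation.Nullary.Decidable using (dec-true; dec-false; _×-dec_)
  open import Relation.Unary using (Pred; Decidable)
  open import Relation.Binary.PropositionalEquality
  open import Function using (_∘_)

  open import Algebra.Properties.Semiring.Sum +-*-semiring public
    using (sum; sum-syntax; sum-cong-≗; ∑-distrib-+; ∑-comm; *-distribˡ-sum; *-distribʳ-sum)

  ∑-const : ∀ n c → ∑[ i < n ] c ≡ + n * c
  ∑-const zero    c = refl
  ∑-const (suc n) c = trans (cong (_+_ c) (∑-const n c)) (sym (suc-* (+ n) c))

  ∑-mono : ∀ {n} {f g : Fin n → ℤ} → (∀ i → f i ≤ g i) → sum f ≤ sum g
  ∑-mono {zero}  f≤g = ≤-refl
  ∑-mono {suc n} f≤g = +-mono-≤ (f≤g zero) (∑-mono (f≤g ∘ suc))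

  ∑-nonNeg : ∀ {n} {f : Fin n → ℤ} → (∀ i → 0ℤ ≤ f i) → 0ℤ ≤ sum f
  ∑-nonNeg {n} {f} 0≤f = subst (_≤ sum f) (trans (∑-const n 0ℤ) (*-zeroʳ (+ n))) (∑-mono 0≤f)

  ∑-*-∑ : ∀ {m n} (f : Fin m → ℤ) (g : Fin n → ℤ) →
          sum f * sum g ≡ ∑[ i < m ] ∑[ j < n ] (f i * g j)
  ∑-*-∑ f g = trans (*-distribʳ-sum (sum g) f)
                    (sum-cong-≗ λ i → *-distribˡ-sum (f i) g)

  *-nonNeg : ∀ {i j} → 0ℤ ≤ i → 0ℤ ≤ j → 0ℤ ≤ i * j
  *-nonNeg {+ m} {+ n} _ _ = subst (0ℤ ≤_) (pos-* m n) (+≤+ z≤n)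

  *-monoˡ-≤-nonNeg′ : ∀ {k x y} → 0ℤ ≤ k → x ≤ y → k * x ≤ k * y
  *-monoˡ-≤-nonNeg′ {k} 0≤k = *-monoˡ-≤-nonNeg k {{nonNegative 0≤k}}

  square-nonNeg : ∀ i → 0ℤ ≤ i * i
  square-nonNeg (+ n)    = *-nonNeg {+ n} {+ n} (+≤+ z≤n) (+≤+ z≤n)
  square-nonNeg -[1+ n ] = +≤+ z≤n

  k*[k*x]≤k*y⇒k*x≤y : ∀ {k x y} → 0ℤ ≤ k → 0ℤ ≤ y → k * (k * x) ≤ k * y → k * x ≤ y
  k*[k*x]≤k*y⇒k*x≤y {+ zero}   _ 0≤y _  = 0≤y
  k*[k*x]≤k*y⇒k*x≤y {+[1+ n ]} _ _   le = *-cancelˡ-≤-pos _ _ +[1+ n ] le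

  ⟦_⟧ : ∀ {p} {P : Set p} → Dec P → ℤ
  ⟦ d ⟧ = if does d then 1ℤ else 0ℤ

  module _ {p} {P : Set p} where

    ⟦⟧-yes : (d : Dec P) → P → ⟦ d ⟧ ≡ 1ℤ
    ⟦⟧-yes d x = cong (if_then 1ℤ else 0ℤ) (dec-true d x)

    ⟦⟧-no : (d : Dec P) → ¬ P → ⟦ d ⟧ ≡ 0ℤ
    ⟦⟧-no d ¬x = cong (if_then 1ℤ else 0ℤ) (dec-false d ¬x)

    ⟦⟧-nonNeg : (d : Dec P) → 0ℤ ≤ ⟦ d ⟧
    ⟦⟧-nonNeg (yes _) = +≤+ z≤n
    ⟦⟧-nonNeg (no _)  = +≤+ z≤n

    ⟦⟧-≤1 : (d : Dec P) → ⟦ d ⟧ ≤ 1ℤ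
    ⟦⟧-≤1 (yes _) = ≤-refl
    ⟦⟧-≤1 (no _)  = +≤+ z≤n

    ⟦⟧-idem : (d : Dec P) → ⟦ d ⟧ * ⟦ d ⟧ ≡ ⟦ d ⟧
    ⟦⟧-idem (yes _) = refl
    ⟦⟧-idem (no _)  = refl

    ⟦⟧*-mono : ∀ {x y} (d : Dec P) → (P → x ≤ y) → ⟦ d ⟧ * x ≤ ⟦ d ⟧ * y
    ⟦⟧*-mono (yes p) x≤y = *-monoˡ-≤-nonNeg 1ℤ (x≤y p)
    ⟦⟧*-mono (no _)  _   = ≤-refl

    ⟦⟧*-cong : ∀ {x y} (d : Dec P) → (P → x ≡ y) → ⟦ d ⟧ * x ≡ ⟦ d ⟧ * y
    ⟦⟧*-cong (yes p) x≡y = cong (1ℤ *_) (x≡y p)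
    ⟦⟧*-cong (no _)  _   = refl

    ⟦⟧*-≤ : ∀ {x} (d : Dec P) → 0ℤ ≤ x → ⟦ d ⟧ * x ≤ x
    ⟦⟧*-≤ (yes _) _   = ≤-reflexive (*-identityˡ _)
    ⟦⟧*-≤ (no _)  0≤x = 0≤x

  ⟦×-dec⟧ : ∀ {p r} {P : Set p} {R : Set r} (d : Dec P) (e : Dec R) →
            ⟦ d ×-dec e ⟧ ≡ ⟦ d ⟧ * ⟦ e ⟧
  ⟦×-dec⟧ (yes _) (yes _) = refl
  ⟦×-dec⟧ (yes _) (no _)  = refl
  ⟦×-dec⟧ (no _)  _       = refl

  δ : ∀ {n} → Fin n → Fin n → ℤ
  δ i j = ⟦ i ≟ j ⟧

  χ : ∀ {n} → Subset n → Fin n → ℤ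
  χ X x = ⟦ x ∈? X ⟧

  ∑-δ : ∀ {n} (i : Fin n) (f : Fin n → ℤ) → ∑[ j < n ] (δ i j * f j) ≡ f i
  ∑-δ {suc n} zero    f = begin
    1ℤ * f zero + ∑[ j < n ] (0ℤ * f (suc j))  ≡⟨ cong₂ _+_ (*-identityˡ (f zero)) (∑-const n 0ℤ) ⟩
    f zero + + n * 0ℤ                        ≡⟨ cong (_+_ (f zero)) (*-zeroʳ (+ n)) ⟩
    f zero + 0ℤ                              ≡⟨ +-identityʳ (f zero) ⟩
    f zero                                   ∎
    where open ≡-Reasoning
  ∑-δ {suc n} (suc i) f = trans (+-identityˡ _) (∑-δ i (f ∘ suc))

  ∑-*-δ : ∀ {n} u (i : Fin n) → ∑[ j < n ] (u * δ i j) ≡ u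
  ∑-*-δ u i = trans (sum-cong-≗ λ j → *-comm u (δ i j)) (∑-δ i (λ _ → u))

  ∑-χ : ∀ {n} (X : Subset n) → ∑[ x < n ] χ X x ≡ + ∣ X ∣
  ∑-χ []            = refl
  ∑-χ (inside ∷ X)  = cong (_+_ 1ℤ) (∑-χ X)
  ∑-χ (outside ∷ X) = trans (+-identityˡ _) (∑-χ X)

  ∑-⟦⟧-≤1 : ∀ {n p} {P : Pred (Fin n) p} (P? : Decidable P) →
            (∀ {i j} → P i → P j → i ≡ j) → ∑[ i < n ] ⟦ P? i ⟧ ≤ 1ℤ
  ∑-⟦⟧-≤1 {zero}          P? unique = +≤+ z≤n
  ∑-⟦⟧-≤1 {suc n} {P = P} P? unique = split (P? zero)
    where
    split : (d : Dec (P zero)) → ⟦ d ⟧ + ∑[ i < n ] ⟦ P? (suc i) ⟧ ≤ 1ℤ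
    split (yes P0) = ≤-reflexive (cong (_+_ 1ℤ) (begin
      ∑[ i < n ] ⟦ P? (suc i) ⟧  ≡⟨ sum-cong-≗ (λ i → ⟦⟧-no (P? (suc i)) (λ Pi → 0≢suc (unique P0 Pi))) ⟩
      ∑[ i < n ] 0ℤ              ≡⟨ ∑-const n 0ℤ ⟩
      + n * 0ℤ                   ≡⟨ *-zeroʳ (+ n) ⟩
      0ℤ                         ∎))
      where
      open ≡-Reasoning
      0≢suc : ∀ {i : Fin n} → zero ≢ suc i
      0≢suc ()
    split (no _) = subst (_≤ 1ℤ) (sym (+-identityˡ _)) (∑-⟦⟧-≤1 (P? ∘ suc) (λ Pi Pj → suc-injective (unique Pi Pj)))

  -- Positive linear functionals and the Cauchy–Schwarz inequality

  record IsPositiveFunctional {I : Set} (S : (I → ℤ) → ℤ) : Set where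
    field
      cong-≗ : ∀ {f g} → (∀ i → f i ≡ g i) → S f ≡ S g
      +-homo : ∀ f g → S (λ i → f i + g i) ≡ S f + S g
      *-homo : ∀ c f → S (λ i → c * f i) ≡ c * S f
      nonNeg : ∀ {f} → (∀ i → 0ℤ ≤ f i) → 0ℤ ≤ S f

    linear₂ : ∀ a b (u v : I → ℤ) → S (λ i → a * u i + b * v i) ≡ a * S u + b * S v
    linear₂ a b u v = trans (+-homo _ _) (cong₂ _+_ (*-homo a u) (*-homo b v))

    linear₃ : ∀ a b c (u v w : I → ℤ) →
              S (λ i → a * u i + b * v i + c * w i) ≡ a * S u + b * S v + c * S w
    linear₃ a b c u v w = trans (+-homo _ _) (cong₂ _+_ (linear₂ a b u v) (*-homo c w))

  ∑-positive : ∀ {n} → IsPositiveFunctional (sum {n})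
  ∑-positive = record
    { cong-≗ = sum-cong-≗
    ; +-homo = ∑-distrib-+
    ; *-homo = λ c f → sym (*-distribˡ-sum c f)
    ; nonNeg = ∑-nonNeg
    }

  ×-positive : ∀ {I J} {S : (I → ℤ) → ℤ} {T : (J → ℤ) → ℤ} →
               IsPositiveFunctional S → IsPositiveFunctional T →
               IsPositiveFunctional (λ f → S (λ i → T (λ j → f (i , j))))
  ×-positive S⁺ T⁺ = record
    { cong-≗ = λ f≗g → S.cong-≗ λ i → T.cong-≗ λ j → f≗g (i , j)
    ; +-homo = λ f g → trans (S.cong-≗ λ i → T.+-homo _ _) (S.+-homo _ _)
    ; *-homo = λ c f → trans (S.cong-≗ λ i → T.*-homo c _) (S.*-homo c _)
    ; nonNeg = λ 0≤f → S.nonNeg λ i → T.nonNeg λ j → 0≤f (i , j)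
    }
    where
    module S = IsPositiveFunctional S⁺
    module T = IsPositiveFunctional T⁺

  module _ {I : Set} {S : (I → ℤ) → ℤ} (S⁺ : IsPositiveFunctional S) (w x : I → ℤ) where
    open IsPositiveFunctional S⁺

    lagrange-identity :
      S (λ i → S (λ j → w i * w j * ((x i - x j) * (x i - x j))))
        ≡ + 2 * (S w * S (λ i → w i * (x i * x i)) - S (λ i → w i * x i) * S (λ i → w i * x i))
    lagrange-identity = begin
      S (λ i → S (λ j → w i * w j * ((x i - x j) * (x i - x j))))
        ≡⟨ cong-≗ (λ i → trans (cong-≗ (λ j → expand (w i) (w j) (x i) (x j)))
                               (linear₃ (w i * (x i * x i)) (w i) ((- + 2) * (w i * x i)) w wx² wx)) ⟩
      S (λ i → w i * (x i * x i) * k + w i * T + (- + 2) * (w i * x i) * A)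
        ≡⟨ cong-≗ (λ i → reorder (w i) (x i) k T A) ⟩
      S (λ i → k * (w i * (x i * x i)) + T * w i + (- + 2) * A * (w i * x i))
        ≡⟨ linear₃ k T ((- + 2) * A) wx² w wx ⟩
      k * T + T * k + (- + 2) * A * A
        ≡⟨ collect k T A ⟩
      + 2 * (k * T - A * A) ∎
      where
      open ≡-Reasoning
      wx wx² : I → ℤ
      wx i = w i * x i
      wx² i = w i * (x i * x i)
      k = S w
      A = S wx
      T = S wx²
      expand : ∀ a b c d → a * b * ((c - d) * (c - d))
                           ≡ a * (c * c) * b + a * (b * (d * d)) + (- + 2) * (a * c) * (b * d)
      expand = solve-∀
      reorder : ∀ a c k T A → a * (c * c) * k + a * T + (- + 2) * (a * c) * A
                              ≡ k * (a * (c * c)) + T * a + (- + 2) * A * (a * c)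
      reorder = solve-∀
      collect : ∀ k T A → k * T + T * k + (- + 2) * A * A ≡ + 2 * (k * T - A * A)
      collect = solve-∀

    cauchy-schwarz : (∀ i → 0ℤ ≤ w i) →
      S (λ i → w i * x i) * S (λ i → w i * x i) ≤ S w * S (λ i → w i * (x i * x i))
    cauchy-schwarz 0≤w = 0≤i-j⇒j≤i (*-cancelˡ-≤-pos 0ℤ _ (+ 2)
      (subst₂ _≤_ (sym (*-zeroʳ (+ 2))) lagrange-identity
        (nonNeg λ i → nonNeg λ j → square-weighted i j)))
      where
      square-weighted : ∀ i j → 0ℤ ≤ w i * w j * ((x i - x j) * (x i - x j))
      square-weighted i j = *-nonNeg (*-nonNeg (0≤w i) (0≤w j)) (square-nonNeg (x i - x j))

  ∑∑ : ∀ {m n} → (Fin m → Fin n → ℤ) → ℤ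
  ∑∑ {m} {n} f = ∑[ i < m ] ∑[ j < n ] f i j

  ∑∑-positive : ∀ {m n} → IsPositiveFunctional {Fin m × Fin n} (λ f → ∑∑ λ i j → f (i , j))
  ∑∑-positive = ×-positive ∑-positive ∑-positive

  ∑∑-const : ∀ {m n} c → ∑∑ {m} {n} (λ _ _ → c) ≡ + m * (+ n * c)
  ∑∑-const {m} {n} c = trans (sum-cong-≗ {m} λ _ → ∑-const n c) (∑-const m (+ n * c))

  ∑∑-cong : ∀ {m n} {f g : Fin m → Fin n → ℤ} → (∀ i j → f i j ≡ g i j) → ∑∑ f ≡ ∑∑ g
  ∑∑-cong f≗g = sum-cong-≗ λ i → sum-cong-≗ (f≗g i)

  ∑∑-mono : ∀ {m n} {f g : Fin m → Fin n → ℤ} → (∀ i j → f i j ≤ g i j) → ∑∑ f ≤ ∑∑ g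
  ∑∑-mono f≤g = ∑-mono λ i → ∑-mono (f≤g i)

  ∑∑-distrib-+ : ∀ {m n} (f g : Fin m → Fin n → ℤ) → ∑∑ (λ i j → f i j + g i j) ≡ ∑∑ f + ∑∑ g
  ∑∑-distrib-+ f g = IsPositiveFunctional.+-homo ∑∑-positive (λ (i , j) → f i j) (λ (i , j) → g i j)

  *-distribˡ-∑∑ : ∀ {m n} c (f : Fin m → Fin n → ℤ) → c * ∑∑ f ≡ ∑∑ λ i j → c * f i j
  *-distribˡ-∑∑ c f = sym (IsPositiveFunctional.*-homo ∑∑-positive c (λ (i , j) → f i j))

  ∑-comm-∑∑ : ∀ {k m n} (F : Fin k → Fin m → Fin n → ℤ) →
              ∑[ p < k ] ∑∑ (F p) ≡ ∑∑ λ a c → ∑[ p < k ] F p a c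
  ∑-comm-∑∑ F = trans (∑-comm (λ p a → ∑[ c < _ ] F p a c)) (sum-cong-≗ λ a → ∑-comm (λ p → F p a))

  ∑∑-comm : ∀ {k l m n} (F : Fin k → Fin l → Fin m → Fin n → ℤ) →
            ∑∑ (λ p b → ∑∑ (F p b)) ≡ ∑∑ λ a c → ∑∑ λ p b → F p b a c
  ∑∑-comm F = trans (sum-cong-≗ λ p → ∑-comm-∑∑ (F p)) (∑-comm-∑∑ λ p a c → ∑[ b < _ ] F p b a c)

  ∑∑-*-∑∑ : ∀ {m n} (f g : Fin m → Fin n → ℤ) →
            ∑∑ f * ∑∑ g ≡ ∑∑ λ a c → ∑∑ λ a′ c′ → f a c * g a′ c′
  ∑∑-*-∑∑ {m} {n} f g = begin
    ∑∑ f * ∑∑ g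
      ≡⟨ ∑-*-∑ (λ a → sum (f a)) (λ a′ → sum (g a′)) ⟩
    ∑[ a < m ] ∑[ a′ < m ] (sum (f a) * sum (g a′))
      ≡⟨ sum-cong-≗ (λ a → sum-cong-≗ λ a′ → ∑-*-∑ (f a) (g a′)) ⟩
    ∑[ a < m ] ∑[ a′ < m ] ∑[ c < n ] ∑[ c′ < n ] (f a c * g a′ c′)
      ≡⟨ sum-cong-≗ (λ a → ∑-comm λ a′ c → ∑[ c′ < n ] (f a c * g a′ c′)) ⟩
    ∑∑ (λ a c → ∑∑ λ a′ c′ → f a c * g a′ c′) ∎
    where open ≡-Reasoning

  ∑∑-δ : ∀ {m n} (i : Fin m) (j : Fin n) (f : Fin m → Fin n → ℤ) →
         ∑∑ (λ i′ j′ → δ i i′ * (δ j j′ * f i′ j′)) ≡ f i j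
  ∑∑-δ {m} {n} i j f = begin
    ∑∑ (λ i′ j′ → δ i i′ * (δ j j′ * f i′ j′))
      ≡⟨ sum-cong-≗ (λ i′ → *-distribˡ-sum (δ i i′) (λ j′ → δ j j′ * f i′ j′)) ⟨
    ∑[ i′ < m ] (δ i i′ * ∑[ j′ < n ] (δ j j′ * f i′ j′))
      ≡⟨ sum-cong-≗ (λ i′ → cong (δ i i′ *_) (∑-δ j (f i′))) ⟩
    ∑[ i′ < m ] (δ i i′ * f i′ j)
      ≡⟨ ∑-δ i (λ i′ → f i′ j) ⟩
    f i j ∎
    where open ≡-Reasoning

-- γ a c is the curve b ↦ γ a c b; the family consists of the curves with W a c, and
-- incidences p b counts those passing through (b , p).
module CurveIncidences {q : ℕ} (γ : Fin q → Fin q → Fin q → Fin q)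
                       {W : Fin q → Fin q → Set} (W? : ∀ a c → Dec (W a c)) where

  open IntegerSums
  open import Data.Fin using (_≟_)
  open import Data.Fin.Subset using (∣_∣; _∈_)
  open import Data.Fin.Subset.Properties using (_∈?_)
  open import Data.Integer using (ℤ; +_; -_; 0ℤ; 1ℤ; _+_; _-_; _*_; _≤_; +≤+)
  open import Data.Integer.Properties
    using (*-assoc; *-zeroʳ; *-identityʳ; +-identityʳ; ≤-trans; i≤j+i; +-monoˡ-≤; module ≤-Reasoning)
  open import Data.Integer.Tactic.RingSolver using (solve-∀)
  open import Data.Nat using (z≤n)
  open import Data.Product using (_×_; _,_)
  open import Relation.Nullary using (yes; no; ¬_)
  open import Relation.Nullary.Decidable using (_×-dec_)
  open import Relation.Binary.PropositionalEquality

  w : Fin q → Fin q → ℤ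
  w a c = ⟦ W? a c ⟧

  size : ℤ
  size = ∑∑ w

  incidences : Fin q → Fin q → ℤ
  incidences p b = ∑∑ λ a c → w a c * δ (γ a c b) p

  second-moment : ℤ
  second-moment = ∑∑ λ p b → incidences p b * incidences p b

  agreements : Fin q → Fin q → Fin q → Fin q → ℤ
  agreements a c a′ c′ = ∑[ b < q ] δ (γ a c b) (γ a′ c′ b)

  size-nonNeg : 0ℤ ≤ size
  size-nonNeg = ∑-nonNeg λ a → ∑-nonNeg λ c → ⟦⟧-nonNeg (W? a c)

  ∑-incidences : ∀ b → ∑[ p < q ] incidences p b ≡ size
  ∑-incidences b = trans (∑-comm-∑∑ λ p a c → w a c * δ (γ a c b) p)
                         (∑∑-cong λ a c → ∑-*-δ (w a c) (γ a c b))

  ∑∑-incidences : ∑∑ incidences ≡ + q * size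
  ∑∑-incidences = begin
    ∑∑ incidences                        ≡⟨ ∑-comm incidences ⟩
    ∑[ b < q ] ∑[ p < q ] incidences p b ≡⟨ sum-cong-≗ ∑-incidences ⟩
    ∑[ b < q ] size                      ≡⟨ ∑-const q size ⟩
    + q * size                           ∎
    where open ≡-Reasoning

  second-moment≡ : second-moment ≡ ∑∑ λ a c → ∑∑ λ a′ c′ → w a c * (w a′ c′ * agreements a c a′ c′)
  second-moment≡ = begin
    ∑∑ (λ p b → incidences p b * incidences p b)
      ≡⟨ ∑∑-cong (λ p b → ∑∑-*-∑∑ (λ a c → w a c * δ (γ a c b) p) (λ a c → w a c * δ (γ a c b) p)) ⟩
    ∑∑ (λ p b → ∑∑ λ a c → ∑∑ λ a′ c′ → term p b a c a′ c′)
      ≡⟨ ∑∑-comm (λ p b a c → ∑∑ (term p b a c)) ⟩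
    ∑∑ (λ a c → ∑∑ λ p b → ∑∑ λ a′ c′ → term p b a c a′ c′)
      ≡⟨ ∑∑-cong (λ a c → ∑∑-comm λ p b → term p b a c) ⟩
    ∑∑ (λ a c → ∑∑ λ a′ c′ → ∑∑ λ p b → term p b a c a′ c′)
      ≡⟨ ∑∑-cong (λ a c → ∑∑-cong λ a′ c′ → ∑∑-term a c a′ c′) ⟩
    ∑∑ (λ a c → ∑∑ λ a′ c′ → w a c * (w a′ c′ * agreements a c a′ c′)) ∎
    where
    open ≡-Reasoning
    term : Fin q → Fin q → Fin q → Fin q → Fin q → Fin q → ℤ
    term p b a c a′ c′ = w a c * δ (γ a c b) p * (w a′ c′ * δ (γ a′ c′ b) p)
    regroup : ∀ x y d e → x * d * (y * e) ≡ e * (x * y * d)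
    regroup = solve-∀
    ∑∑-term : ∀ a c a′ c′ → ∑∑ (λ p b → term p b a c a′ c′) ≡ w a c * (w a′ c′ * agreements a c a′ c′)
    ∑∑-term a c a′ c′ = begin
      ∑∑ (λ p b → term p b a c a′ c′)
        ≡⟨ ∑-comm (λ p b → term p b a c a′ c′) ⟩
      ∑[ b < q ] ∑[ p < q ] term p b a c a′ c′
        ≡⟨ sum-cong-≗ (λ b → sum-cong-≗ λ p → regroup (w a c) (w a′ c′) (δ (γ a c b) p) (δ (γ a′ c′ b) p)) ⟩
      ∑[ b < q ] ∑[ p < q ] (δ (γ a′ c′ b) p * (w a c * w a′ c′ * δ (γ a c b) p))
        ≡⟨ sum-cong-≗ (λ b → ∑-δ (γ a′ c′ b) _) ⟩
      ∑[ b < q ] (w a c * w a′ c′ * δ (γ a c b) (γ a′ c′ b))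
        ≡⟨ *-distribˡ-sum (w a c * w a′ c′) (λ b → δ (γ a c b) (γ a′ c′ b)) ⟨
      w a c * w a′ c′ * agreements a c a′ c′
        ≡⟨ *-assoc (w a c) (w a′ c′) _ ⟩
      w a c * (w a′ c′ * agreements a c a′ c′) ∎

  agreement-bound : Fin q → Fin q → Fin q → Fin q → ℤ
  agreement-bound a c a′ c′ = 1ℤ + + q * (δ a a′ * δ c c′)

  ∑∑-weighted-agreement-bound :
    ∑∑ (λ a c → ∑∑ λ a′ c′ → w a c * (w a′ c′ * agreement-bound a c a′ c′)) ≡ size * size + + q * size
  ∑∑-weighted-agreement-bound = begin
    ∑∑ (λ a c → ∑∑ λ a′ c′ → w a c * (w a′ c′ * agreement-bound a c a′ c′))
      ≡⟨ ∑∑-cong (λ a c → ∑∑-cong λ a′ c′ → expand (w a c) (w a′ c′) (+ q) (δ a a′) (δ c c′)) ⟩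
    ∑∑ (λ a c → ∑∑ λ a′ c′ → w a c * w a′ c′ + diagonal a c a′ c′)
      ≡⟨ ∑∑-cong (λ a c → ∑∑-distrib-+ (λ a′ c′ → w a c * w a′ c′) (diagonal a c)) ⟩
    ∑∑ (λ a c → ∑∑ (λ a′ c′ → w a c * w a′ c′) + ∑∑ (diagonal a c))
      ≡⟨ ∑∑-distrib-+ (λ a c → ∑∑ λ a′ c′ → w a c * w a′ c′) (λ a c → ∑∑ (diagonal a c)) ⟩
    ∑∑ (λ a c → ∑∑ λ a′ c′ → w a c * w a′ c′) + ∑∑ (λ a c → ∑∑ (diagonal a c))
      ≡⟨ cong₂ _+_ (∑∑-*-∑∑ w w) (∑∑-cong λ a c → sym (∑∑-diagonal a c)) ⟨
    size * size + ∑∑ (λ a c → + q * (w a c * w a c))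
      ≡⟨ cong (_+_ (size * size)) (∑∑-cong λ a c → cong (+ q *_) (⟦⟧-idem (W? a c))) ⟩
    size * size + ∑∑ (λ a c → + q * w a c)
      ≡⟨ cong (_+_ (size * size)) (*-distribˡ-∑∑ (+ q) w) ⟨
    size * size + + q * size ∎
    where
    open ≡-Reasoning
    expand : ∀ x y q d e → x * (y * (1ℤ + q * (d * e))) ≡ x * y + q * x * (d * (e * y))
    expand = solve-∀
    diagonal : Fin q → Fin q → Fin q → Fin q → ℤ
    diagonal a c a′ c′ = + q * w a c * (δ a a′ * (δ c c′ * w a′ c′))
    ∑∑-diagonal : ∀ a c → ∑∑ (diagonal a c) ≡ + q * (w a c * w a c)
    ∑∑-diagonal a c = begin
      ∑∑ (diagonal a c)
        ≡⟨ *-distribˡ-∑∑ (+ q * w a c) (λ a′ c′ → δ a a′ * (δ c c′ * w a′ c′)) ⟨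
      + q * w a c * ∑∑ (λ a′ c′ → δ a a′ * (δ c c′ * w a′ c′))
        ≡⟨ cong (+ q * w a c *_) (∑∑-δ a c w) ⟩
      + q * w a c * w a c
        ≡⟨ *-assoc (+ q) (w a c) (w a c) ⟩
      + q * (w a c * w a c) ∎

  module _ (meet-once : ∀ {a c a′ c′ b₁ b₂} → W a c → W a′ c′ → ¬ (a ≡ a′ × c ≡ c′) →
                        γ a c b₁ ≡ γ a′ c′ b₁ → γ a c b₂ ≡ γ a′ c′ b₂ → b₁ ≡ b₂) where

    agreements-≤ : ∀ {a c a′ c′} → W a c → W a′ c′ → agreements a c a′ c′ ≤ agreement-bound a c a′ c′
    agreements-≤ {a} {c} {a′} {c′} Wac Wa′c′ =
      subst (λ d → agreements a c a′ c′ ≤ 1ℤ + + q * d) (⟦×-dec⟧ (a ≟ a′) (c ≟ c′))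
            (by-cases ((a ≟ a′) ×-dec (c ≟ c′)))
      where
      by-cases : (same? : Dec (a ≡ a′ × c ≡ c′)) → agreements a c a′ c′ ≤ 1ℤ + + q * ⟦ same? ⟧
      by-cases (yes (refl , refl)) = ≤-trans
        (subst (agreements a c a c ≤_) (∑-const q 1ℤ) (∑-mono λ b → ⟦⟧-≤1 (γ a c b ≟ γ a c b)))
        (i≤j+i _ 1ℤ)
      by-cases (no distinct) = subst (agreements a c a′ c′ ≤_) (sym 1+q*0≡1)
        (∑-⟦⟧-≤1 (λ b → γ a c b ≟ γ a′ c′ b) (meet-once Wac Wa′c′ distinct))
        where
        1+q*0≡1 : 1ℤ + + q * 0ℤ ≡ 1ℤ
        1+q*0≡1 = trans (cong (_+_ 1ℤ) (*-zeroʳ (+ q))) (+-identityʳ 1ℤ)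

    second-moment-≤ : second-moment ≤ size * size + + q * size
    second-moment-≤ = begin
      second-moment
        ≡⟨ second-moment≡ ⟩
      ∑∑ (λ a c → ∑∑ λ a′ c′ → w a c * (w a′ c′ * agreements a c a′ c′))
        ≤⟨ ∑∑-mono (λ a c → ∑∑-mono λ a′ c′ → ⟦⟧*-mono (W? a c) λ Wac →
                                               ⟦⟧*-mono (W? a′ c′) λ Wa′c′ → agreements-≤ Wac Wa′c′) ⟩
      ∑∑ (λ a c → ∑∑ λ a′ c′ → w a c * (w a′ c′ * agreement-bound a c a′ c′))
        ≡⟨ ∑∑-weighted-agreement-bound ⟩
      size * size + + q * size ∎
      where open ≤-Reasoning

    deviation : Fin q → Fin q → ℤ
    deviation p b = + q * incidences p b - size

    ∑∑-deviation²-≤ : ∑∑ (λ p b → deviation p b * deviation p b) ≤ + q * + q * + q * size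
    ∑∑-deviation²-≤ = begin
      ∑∑ (λ p b → deviation p b * deviation p b)
        ≡⟨ ∑∑-cong (λ p b → expand (+ q) (incidences p b) size) ⟩
      ∑∑ (λ p b → + q * + q * (incidences p b * incidences p b) + (- + 2) * + q * size * incidences p b
                  + size * size * 1ℤ)
        ≡⟨ linear₃ (+ q * + q) ((- + 2) * + q * size) (size * size)
                   (λ (p , b) → incidences p b * incidences p b) (λ (p , b) → incidences p b) (λ _ → 1ℤ) ⟩
      + q * + q * second-moment + (- + 2) * + q * size * ∑∑ incidences + size * size * ∑∑ {q} {q} (λ _ _ → 1ℤ)
        ≡⟨ cong₂ (λ s t → + q * + q * second-moment + (- + 2) * + q * size * s + size * size * t)
                 ∑∑-incidences (∑∑-const {q} {q} 1ℤ) ⟩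
      + q * + q * second-moment + (- + 2) * + q * size * (+ q * size) + size * size * (+ q * (+ q * 1ℤ))
        ≤⟨ +-monoˡ-≤ _ (+-monoˡ-≤ _ (*-monoˡ-≤-nonNeg′ (square-nonNeg (+ q)) second-moment-≤)) ⟩
      + q * + q * (size * size + + q * size) + (- + 2) * + q * size * (+ q * size)
        + size * size * (+ q * (+ q * 1ℤ))
        ≡⟨ collect (+ q) size ⟩
      + q * + q * + q * size ∎
      where
      open ≤-Reasoning
      open IsPositiveFunctional (∑∑-positive {q} {q}) using (linear₃)
      expand : ∀ q g m → (q * g - m) * (q * g - m) ≡ q * q * (g * g) + (- + 2) * q * m * g + m * m * 1ℤ
      expand = solve-∀
      collect : ∀ q m → q * q * (m * m + q * m) + (- + 2) * q * m * (q * m) + m * m * (q * (q * 1ℤ))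
                        ≡ q * q * q * m
      collect = solve-∀

    module _ (B P : Subset q) (γ-∈ : ∀ {a c b} → W a c → b ∈ B → γ a c b ∈ P) where

      χ*incidences : ∀ p {b} → b ∈ B → χ P p * incidences p b ≡ incidences p b
      χ*incidences p {b} b∈B = begin
        χ P p * incidences p b
          ≡⟨ *-distribˡ-∑∑ (χ P p) (λ a c → w a c * δ (γ a c b) p) ⟩
        ∑∑ (λ a c → χ P p * (w a c * δ (γ a c b) p))
          ≡⟨ ∑∑-cong (λ a c → absorb (W? a c) (γ a c b ≟ p)) ⟩
        incidences p b ∎
        where
        open ≡-Reasoning
        absorb : ∀ {a c} (d : Dec (W a c)) (e : Dec (γ a c b ≡ p)) →
                 χ P p * (⟦ d ⟧ * ⟦ e ⟧) ≡ ⟦ d ⟧ * ⟦ e ⟧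
        absorb (yes Wac) (yes eq) = trans (*-identityʳ _) (⟦⟧-yes (p ∈? P) (subst (_∈ P) eq (γ-∈ Wac b∈B)))
        absorb (yes _)   (no _)   = *-zeroʳ (χ P p)
        absorb (no _)    _        = *-zeroʳ (χ P p)

      ∑∑-χχ-incidences : ∑∑ (λ p b → χ P p * χ B b * incidences p b) ≡ + ∣ B ∣ * size
      ∑∑-χχ-incidences = begin
        ∑∑ (λ p b → χ P p * χ B b * incidences p b)
          ≡⟨ ∑-comm (λ p b → χ P p * χ B b * incidences p b) ⟩
        ∑[ b < q ] ∑[ p < q ] (χ P p * χ B b * incidences p b)
          ≡⟨ sum-cong-≗ (λ b → sum-cong-≗ λ p → regroup (χ P p) (χ B b) (incidences p b)) ⟩
        ∑[ b < q ] ∑[ p < q ] (χ B b * (χ P p * incidences p b))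
          ≡⟨ sum-cong-≗ (λ b → *-distribˡ-sum (χ B b) (λ p → χ P p * incidences p b)) ⟨
        ∑[ b < q ] (χ B b * ∑[ p < q ] (χ P p * incidences p b))
          ≡⟨ sum-cong-≗ (λ b → ⟦⟧*-cong (b ∈? B) λ b∈B →
                                 trans (sum-cong-≗ λ p → χ*incidences p b∈B) (∑-incidences b)) ⟩
        ∑[ b < q ] (χ B b * size)
          ≡⟨ *-distribʳ-sum size (χ B) ⟨
        sum (χ B) * size
          ≡⟨ cong (_* size) (∑-χ B) ⟩
        + ∣ B ∣ * size ∎
        where
        open ≡-Reasoning
        regroup : ∀ x y z → x * y * z ≡ y * (x * z)
        regroup = solve-∀

      ∑∑-χχ : ∑∑ (λ p b → χ P p * χ B b) ≡ + ∣ P ∣ * + ∣ B ∣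
      ∑∑-χχ = trans (sym (∑-*-∑ (χ P) (χ B))) (cong₂ _*_ (∑-χ P) (∑-χ B))

      ∑∑-χχ-deviation : ∑∑ (λ p b → χ P p * χ B b * deviation p b) ≡ size * + ∣ B ∣ * (+ q - + ∣ P ∣)
      ∑∑-χχ-deviation = begin
        ∑∑ (λ p b → χ P p * χ B b * deviation p b)
          ≡⟨ ∑∑-cong (λ p b → distribute (χ P p * χ B b) (+ q) (incidences p b) size) ⟩
        ∑∑ (λ p b → + q * (χ P p * χ B b * incidences p b) + (- size) * (χ P p * χ B b))
          ≡⟨ IsPositiveFunctional.linear₂ ∑∑-positive (+ q) (- size)
               (λ (p , b) → χ P p * χ B b * incidences p b) (λ (p , b) → χ P p * χ B b) ⟩
        + q * ∑∑ (λ p b → χ P p * χ B b * incidences p b) + (- size) * ∑∑ (λ p b → χ P p * χ B b)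
          ≡⟨ cong₂ (λ s t → + q * s + (- size) * t) ∑∑-χχ-incidences ∑∑-χχ ⟩
        + q * (+ ∣ B ∣ * size) + (- size) * (+ ∣ P ∣ * + ∣ B ∣)
          ≡⟨ factor (+ q) (+ ∣ B ∣) (+ ∣ P ∣) size ⟩
        size * + ∣ B ∣ * (+ q - + ∣ P ∣) ∎
        where
        open ≡-Reasoning
        distribute : ∀ w q g m → w * (q * g - m) ≡ q * (w * g) + (- m) * w
        distribute = solve-∀
        factor : ∀ q B P m → q * (B * m) + (- m) * (P * B) ≡ m * B * (q - P)
        factor = solve-∀

      χχ-deviation²-≤ : ∀ p b → χ P p * χ B b * (deviation p b * deviation p b) ≤ deviation p b * deviation p b
      χχ-deviation²-≤ p b = begin
        χ P p * χ B b * (deviation p b * deviation p b)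
          ≡⟨ *-assoc (χ P p) (χ B b) _ ⟩
        χ P p * (χ B b * (deviation p b * deviation p b))
          ≤⟨ ⟦⟧*-≤ (p ∈? P) (*-nonNeg (⟦⟧-nonNeg (b ∈? B)) (square-nonNeg (deviation p b))) ⟩
        χ B b * (deviation p b * deviation p b)
          ≤⟨ ⟦⟧*-≤ (b ∈? B) (square-nonNeg (deviation p b)) ⟩
        deviation p b * deviation p b ∎
        where open ≤-Reasoning

      incidence-bound : size * + ∣ B ∣ * ((+ q - + ∣ P ∣) * (+ q - + ∣ P ∣)) ≤ + ∣ P ∣ * (+ q * + q * + q)
      incidence-bound = k*[k*x]≤k*y⇒k*x≤y (*-nonNeg size-nonNeg (+≤+ z≤n))
          (*-nonNeg {+ ∣ P ∣} (+≤+ z≤n) (*-nonNeg {+ q * + q} {+ q} (square-nonNeg (+ q)) (+≤+ z≤n))) (begin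
        k * (k * (R * R))
          ≡⟨ square-product k R ⟩
        k * R * (k * R)
          ≡⟨ cong₂ _*_ ∑∑-χχ-deviation ∑∑-χχ-deviation ⟨
        ∑∑ (λ p b → χ P p * χ B b * deviation p b) * ∑∑ (λ p b → χ P p * χ B b * deviation p b)
          ≤⟨ cauchy-schwarz ∑∑-positive (λ (p , b) → χ P p * χ B b) (λ (p , b) → deviation p b)
                            (λ (p , b) → *-nonNeg (⟦⟧-nonNeg (p ∈? P)) (⟦⟧-nonNeg (b ∈? B))) ⟩
        ∑∑ (λ p b → χ P p * χ B b) * ∑∑ (λ p b → χ P p * χ B b * (deviation p b * deviation p b))
          ≤⟨ *-monoˡ-≤-nonNeg′ 0≤∑∑-χχ
                              (≤-trans (∑∑-mono χχ-deviation²-≤) ∑∑-deviation²-≤) ⟩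
        ∑∑ (λ p b → χ P p * χ B b) * (+ q * + q * + q * size)
          ≡⟨ cong (_* (+ q * + q * + q * size)) ∑∑-χχ ⟩
        + ∣ P ∣ * + ∣ B ∣ * (+ q * + q * + q * size)
          ≡⟨ rearrange (+ ∣ P ∣) (+ ∣ B ∣) (+ q * + q * + q) size ⟩
        k * (+ ∣ P ∣ * (+ q * + q * + q)) ∎)
        where
        open ≤-Reasoning
        k = size * + ∣ B ∣
        R = + q - + ∣ P ∣
        0≤∑∑-χχ : 0ℤ ≤ ∑∑ λ p b → χ P p * χ B b
        0≤∑∑-χχ = subst (0ℤ ≤_) (sym ∑∑-χχ) (*-nonNeg {+ ∣ P ∣} {+ ∣ B ∣} (+≤+ z≤n) (+≤+ z≤n))
        square-product : ∀ k R → k * (k * (R * R)) ≡ k * R * (k * R)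
        square-product = solve-∀
        rearrange : ∀ P B Q m → P * B * (Q * m) ≡ m * B * (P * Q)
        rearrange = solve-∀

module QuasifieldProperties {q : ℕ} (Q : Quasifield q) where

  open Quasifield Q
  open import Level using (0ℓ)
  open import Relation.Binary.PropositionalEquality
  open import Algebra.Bundles using (Group)
  open import Algebra.Structures using (IsGroup)
  open import Algebra.Definitions {A = Fin q} _≡_ using (AlmostLeftCancellative)
  open import Data.Empty using (⊥-elim)
  open import Data.Fin using (_≟_)
  open import Data.Product using (_×_; _,_; proj₂)
  open import Relation.Nullary using (yes; no; ¬_)
  open import Relation.Binary.PropositionalEquality.Algebra using (isMagma)

  ⊕-isGroup : IsGroup _≡_ _⊕_ 𝟘 ⊖_
  ⊕-isGroup = record
    { isMonoid = record
      { isSemigroup = record { isMagma = isMagma _⊕_ ; assoc = ⊕-assoc }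
      ; identity    = ⊕-identityˡ , ⊕-identityʳ
      }
    ; inverse = ⊕-inverseˡ , ⊕-inverseʳ
    ; ⁻¹-cong = cong ⊖_
    }

  ⊕-group : Group 0ℓ 0ℓ
  ⊕-group = record { isGroup = ⊕-isGroup }

  open import Algebra.Properties.Group ⊕-group
    using (∙-cancelˡ; ∙-cancelʳ; identityʳ-unique; \\-leftDividesˡ)

  ⊙-zeroʳ : ∀ a → a ⊙ 𝟘 ≡ 𝟘
  ⊙-zeroʳ a = identityʳ-unique (a ⊙ 𝟘) (a ⊙ 𝟘)
    (trans (sym (distribˡ a 𝟘 𝟘)) (cong (a ⊙_) (⊕-identityˡ 𝟘)))

  ⊙-almostCancelˡ : AlmostLeftCancellative 𝟘 _⊙_
  ⊙-almostCancelˡ a x y a≢0 ax≡ay with x ≟ 𝟘 | y ≟ 𝟘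
  ... | yes refl | yes refl = refl
  ... | yes refl | no y≢0   = ⊥-elim (⊙-closed a y a≢0 y≢0 (trans (sym ax≡ay) (⊙-zeroʳ a)))
  ... | no x≢0   | yes refl = ⊥-elim (⊙-closed a x a≢0 x≢0 (trans ax≡ay (⊙-zeroʳ a)))
  ... | no x≢0   | no y≢0   = trans (unique x (x≢0 , refl)) (sym (unique y (y≢0 , sym ax≡ay)))
    where unique = proj₂ (proj₂ (⊙-leftDiv a (a ⊙ x) a≢0 (⊙-closed a x a≢0 x≢0)))

  curve : Fin q → Fin q → Fin q → Fin q
  curve a c b = a ⊙ (b ⊕ c)

  curves-meet-once : ∀ {a c a′ c′ b₁ b₂} → a ≢ 𝟘 → ¬ (a ≡ a′ × c ≡ c′) →
                     curve a c b₁ ≡ curve a′ c′ b₁ → curve a c b₂ ≡ curve a′ c′ b₂ → b₁ ≡ b₂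
  curves-meet-once {a} {c} {a′} {c′} {b₁} {b₂} a≢0 distinct meet₁ meet₂ with a ≟ a′
  ... | yes refl = ⊥-elim (distinct (refl , ∙-cancelˡ b₁ c c′ (⊙-almostCancelˡ a _ _ a≢0 meet₁)))
  ... | no a≢a′  = ∙-cancelʳ c b₁ b₂ (trans (unique (b₁ ⊕ c) (planar-form meet₁))
                                            (sym (unique (b₂ ⊕ c) (planar-form meet₂))))
    where
    unique = proj₂ (proj₂ (planar a a′ (a′ ⊙ (⊖ c ⊕ c′)) a≢a′))
    planar-form : ∀ {b} → curve a c b ≡ curve a′ c′ b → a ⊙ (b ⊕ c) ≡ a′ ⊙ (b ⊕ c) ⊕ a′ ⊙ (⊖ c ⊕ c′)
    planar-form {b} meet = begin
      a ⊙ (b ⊕ c)                       ≡⟨ meet ⟩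
      a′ ⊙ (b ⊕ c′)                     ≡⟨ cong (λ z → a′ ⊙ (b ⊕ z)) (\\-leftDividesˡ c c′) ⟨
      a′ ⊙ (b ⊕ (c ⊕ (⊖ c ⊕ c′)))       ≡⟨ cong (a′ ⊙_) (⊕-assoc b c _) ⟨
      a′ ⊙ ((b ⊕ c) ⊕ (⊖ c ⊕ c′))       ≡⟨ distribˡ a′ _ _ ⟩
      a′ ⊙ (b ⊕ c) ⊕ a′ ⊙ (⊖ c ⊕ c′)   ∎
      where open ≡-Reasoning

module SubsetProperties where

  open import Data.Bool using (Bool; true)
  open import Data.Nat using (suc; _≤_; _<_; z≤n; s≤s)
  open import Data.Nat.Properties using (≤-reflexive; m≤n⇒m≤1+n; <-≤-trans; n≮0)
  open import Data.Fin.Subset using (∣_∣; _∈_; _∉_; _-_; inside; outside; Nonempty)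
  open import Data.Fin.Subset.Properties using (p─⊥≡p; ∣p∣≤∣x∷p∣; nonempty?; Empty-unique; ∣⊥∣≡0)
  open import Data.Empty using (⊥-elim)
  open import Data.Fin using (zero; suc)
  open import Data.Vec using (_∷_; tabulate; here; there)
  open import Data.Vec.Properties using (lookup∘tabulate; lookup⇒[]=)
  open import Relation.Binary.PropositionalEquality
  open import Relation.Nullary using (yes; no)

  ∈-tabulate : ∀ {n} {f : Fin n → Bool} {x} → f x ≡ true → x ∈ tabulate f
  ∈-tabulate {f = f} {x} fx = lookup⇒[]= x (tabulate f) (trans (lookup∘tabulate f x) fx)

  x∉p-x : ∀ {n} (p : Subset n) x → x ∉ p - x
  x∉p-x (inside ∷ p)  zero    ()
  x∉p-x (outside ∷ p) zero    ()
  x∉p-x (_ ∷ p)       (suc x) (there x∈p-x) = x∉p-x p x x∈p-x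

  ∣p∣≤1+∣p-x∣ : ∀ {n} (p : Subset n) x → ∣ p ∣ ≤ suc ∣ p - x ∣
  ∣p∣≤1+∣p-x∣ (inside ∷ p)  zero    = s≤s (≤-reflexive (cong ∣_∣ (sym (p─⊥≡p p))))
  ∣p∣≤1+∣p-x∣ (outside ∷ p) zero    = m≤n⇒m≤1+n (≤-reflexive (cong ∣_∣ (sym (p─⊥≡p p))))
  ∣p∣≤1+∣p-x∣ (inside ∷ p)  (suc x) = s≤s (∣p∣≤1+∣p-x∣ p x)
  ∣p∣≤1+∣p-x∣ (outside ∷ p) (suc x) = ∣p∣≤1+∣p-x∣ p x

  x∈p⇒0<∣p∣ : ∀ {n} {p : Subset n} {x} → x ∈ p → 0 < ∣ p ∣
  x∈p⇒0<∣p∣ here                    = s≤s z≤n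
  x∈p⇒0<∣p∣ {p = s ∷ p} (there x∈p) = <-≤-trans (x∈p⇒0<∣p∣ x∈p) (∣p∣≤∣x∷p∣ s p)

  0<∣p∣⇒nonempty : ∀ {n} {p : Subset n} → 0 < ∣ p ∣ → Nonempty p
  0<∣p∣⇒nonempty {n} {p} 0<∣p∣ with nonempty? p
  ... | yes nonempty = nonempty
  ... | no empty     = ⊥-elim (n≮0 (subst (0 <_) (trans (cong ∣_∣ (Empty-unique empty)) (∣⊥∣≡0 n)) 0<∣p∣))

module ProductSumSet {q : ℕ} (Q : Quasifield q) (A : Subset q) where

  open Quasifield Q
  open QuasifieldProperties Q using (curve; curves-meet-once)
  open SubsetProperties
  open IntegerSums
  open import Data.Nat as ℕ using (ℕ; _∸_; _<_)
  open import Data.Fin.Properties using (any?)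
  open import Data.Fin.Subset using (∣_∣; _∈_; _-_)
  open import Data.Fin.Subset.Properties using (_∈?_; p─q⊆p; ∣p∣≤n)
  open import Data.Integer as ℤ using (ℤ; +_; _≤_)
  open import Data.Integer.Properties using (pos-*; [+m]-[+n]≡m⊖n; ⊖-≥; drop‿+≤+)
  open import Data.Product using (_×_; _,_)
  open import Relation.Binary.PropositionalEquality
  open import Relation.Nullary using (¬_)
  open import Relation.Nullary.Decidable using (dec-true; _×-dec_)

  P : Subset q
  P = prodSumSet Q A

  ∈-sumSet : ∀ {a b} → a ∈ A → b ∈ A → a ⊕ b ∈ sumSet Q A
  ∈-sumSet {a} {b} a∈A b∈A = ∈-tabulate (dec-true (any? _) (a , b , a∈A , b∈A , refl))

  ∈-prodSumSet : ∀ {a b c} → a ∈ A → b ∈ A → c ∈ A → curve a c b ∈ P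
  ∈-prodSumSet {a} {b} {c} a∈A b∈A c∈A =
    ∈-tabulate (dec-true (any? _) (a , b ⊕ c , a∈A , ∈-sumSet b∈A c∈A , refl))

  prodSumSet-nonempty : 0 < ∣ A ∣ → 0 < ∣ P ∣
  prodSumSet-nonempty 0<∣A∣ = let (a , a∈A) = 0<∣p∣⇒nonempty 0<∣A∣ in x∈p⇒0<∣p∣ (∈-prodSumSet a∈A a∈A a∈A)

  -- Slope 0 is excluded because all the curves 0 ⊙ (b ⊕ c) coincide.
  open CurveIncidences curve (λ a c → (a ∈? A - 𝟘) ×-dec (c ∈? A))

  size≡ : size ≡ + (∣ A - 𝟘 ∣ ℕ.* ∣ A ∣)
  size≡ = begin
    ∑∑ (λ a c → ⟦ (a ∈? A - 𝟘) ×-dec (c ∈? A) ⟧)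
      ≡⟨ ∑∑-cong (λ a c → ⟦×-dec⟧ (a ∈? A - 𝟘) (c ∈? A)) ⟩
    ∑∑ (λ a c → χ (A - 𝟘) a ℤ.* χ A c)
      ≡⟨ ∑-*-∑ (χ (A - 𝟘)) (χ A) ⟨
    sum (χ (A - 𝟘)) ℤ.* sum (χ A)
      ≡⟨ cong₂ ℤ._*_ (∑-χ (A - 𝟘)) (∑-χ A) ⟩
    + ∣ A - 𝟘 ∣ ℤ.* + ∣ A ∣
      ≡⟨ pos-* ∣ A - 𝟘 ∣ ∣ A ∣ ⟨
    + (∣ A - 𝟘 ∣ ℕ.* ∣ A ∣) ∎
    where open ≡-Reasoning

  slopes-meet-once : ∀ {a c a′ c′ b₁ b₂} → a ∈ A - 𝟘 × c ∈ A → a′ ∈ A - 𝟘 × c′ ∈ A →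
                     ¬ (a ≡ a′ × c ≡ c′) →
                     curve a c b₁ ≡ curve a′ c′ b₁ → curve a c b₂ ≡ curve a′ c′ b₂ → b₁ ≡ b₂
  slopes-meet-once (a∈A* , _) _ = curves-meet-once (λ a≡0 → x∉p-x A 𝟘 (subst (_∈ A - 𝟘) a≡0 a∈A*))

  curve-∈-P : ∀ {a c b} → a ∈ A - 𝟘 × c ∈ A → b ∈ A → curve a c b ∈ P
  curve-∈-P (a∈A* , c∈A) b∈A = ∈-prodSumSet (p─q⊆p A _ a∈A*) b∈A c∈A

  prodSumSet-bound : ∣ A - 𝟘 ∣ ℕ.* ∣ A ∣ ℕ.* ∣ A ∣ ℕ.* ((q ∸ ∣ P ∣) ℕ.* (q ∸ ∣ P ∣))
                     ℕ.≤ ∣ P ∣ ℕ.* (q ℕ.* q ℕ.* q)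
  prodSumSet-bound = drop‿+≤+ (subst₂ _≤_ lhs rhs (incidence-bound slopes-meet-once A P curve-∈-P))
    where
    open ≡-Reasoning
    N′ N R : ℕ
    N′ = ∣ A - 𝟘 ∣
    N = ∣ A ∣
    R = q ∸ ∣ P ∣
    R≡ : + q ℤ.- + ∣ P ∣ ≡ + R
    R≡ = trans ([+m]-[+n]≡m⊖n q ∣ P ∣) (⊖-≥ (∣p∣≤n P))
    lhs : size ℤ.* + N ℤ.* ((+ q ℤ.- + ∣ P ∣) ℤ.* (+ q ℤ.- + ∣ P ∣)) ≡ + (N′ ℕ.* N ℕ.* N ℕ.* (R ℕ.* R))
    lhs = begin
      size ℤ.* + N ℤ.* ((+ q ℤ.- + ∣ P ∣) ℤ.* (+ q ℤ.- + ∣ P ∣))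
        ≡⟨ cong₂ (λ s r → s ℤ.* + N ℤ.* (r ℤ.* r)) size≡ R≡ ⟩
      + (N′ ℕ.* N) ℤ.* + N ℤ.* (+ R ℤ.* + R)
        ≡⟨ cong₂ ℤ._*_ (pos-* (N′ ℕ.* N) N) (pos-* R R) ⟨
      + (N′ ℕ.* N ℕ.* N) ℤ.* + (R ℕ.* R)
        ≡⟨ pos-* (N′ ℕ.* N ℕ.* N) (R ℕ.* R) ⟨
      + (N′ ℕ.* N ℕ.* N ℕ.* (R ℕ.* R)) ∎
    rhs : + ∣ P ∣ ℤ.* (+ q ℤ.* + q ℤ.* + q) ≡ + (∣ P ∣ ℕ.* (q ℕ.* q ℕ.* q))
    rhs = begin
      + ∣ P ∣ ℤ.* (+ q ℤ.* + q ℤ.* + q)  ≡⟨ cong (λ z → + ∣ P ∣ ℤ.* (z ℤ.* + q)) (pos-* q q) ⟨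
      + ∣ P ∣ ℤ.* (+ (q ℕ.* q) ℤ.* + q)  ≡⟨ cong (+ ∣ P ∣ ℤ.*_) (pos-* (q ℕ.* q) q) ⟨
      + ∣ P ∣ ℤ.* + (q ℕ.* q ℕ.* q)      ≡⟨ pos-* ∣ P ∣ (q ℕ.* q ℕ.* q) ⟨
      + (∣ P ∣ ℕ.* (q ℕ.* q ℕ.* q))      ∎

module Arithmetic where

  open import Data.Nat
  open import Data.Nat.Properties
  open import Data.Nat.Tactic.RingSolver using (solve-∀)
  open import Data.Sum using (_⊎_; inj₁; inj₂)
  open import Relation.Nullary using (yes; no; contradiction)
  open import Relation.Binary.PropositionalEquality

  m*m≤n*n⇒m≤n : ∀ {m n} → m * m ≤ n * n → m ≤ n
  m*m≤n*n⇒m≤n {m} {n} m²≤n² with m ≤? n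
  ... | yes m≤n = m≤n
  ... | no  m≰n = contradiction m²≤n² (<⇒≱ (*-mono-< (≰⇒> m≰n) (≰⇒> m≰n)))

  n³≤2n′n² : ∀ {n n′} → 2 ≤ n → n ≤ suc n′ → n ^ 3 ≤ 2 * (n′ * n * n)
  n³≤2n′n² {n} {n′} 2≤n n≤1+n′ = begin
    n ^ 3             ≡⟨ cube n ⟩
    n * n * n         ≤⟨ *-monoˡ-≤ n (*-monoˡ-≤ n n≤n′+n′) ⟩
    (n′ + n′) * n * n ≡⟨ double n′ n ⟩
    2 * (n′ * n * n)  ∎
    where
    open ≤-Reasoning
    n≤n′+n′ : n ≤ n′ + n′
    n≤n′+n′ = ≤-trans n≤1+n′ (+-monoˡ-≤ n′ (s≤s⁻¹ (≤-trans 2≤n n≤1+n′)))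
    cube : ∀ n → n ^ 3 ≡ n * n * n
    cube n = trans (cong (λ z → n * (n * z)) (*-identityʳ n)) (sym (*-assoc n n n))
    double : ∀ m n → (m + m) * n * n ≡ 2 * (m * n * n)
    double = solve-∀

  2≤n³⇒2≤n : ∀ n → 2 ≤ n ^ 3 → 2 ≤ n
  2≤n³⇒2≤n zero          ()
  2≤n³⇒2≤n (suc zero)    (s≤s ())
  2≤n³⇒2≤n (suc (suc n)) _ = s≤s (s≤s z≤n)

  n′n²≤m⇒n³≤2m : ∀ {n n′ m} → n ≤ suc n′ → (0 < n → 0 < m) → n′ * n * n ≤ m → n ^ 3 ≤ 2 * m
  n′n²≤m⇒n³≤2m {zero}                _      _   _     = z≤n
  n′n²≤m⇒n³≤2m {suc zero}    {m = m} _      0<m _     = ≤-trans (0<m (s≤s z≤n)) (m≤m+n m (m + 0))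
  n′n²≤m⇒n³≤2m {suc (suc k)}         n≤1+n′ _   n′n²≤m =
    ≤-trans (n³≤2n′n² (s≤s (s≤s z≤n)) n≤1+n′) (*-monoʳ-≤ 2 n′n²≤m)

  2d²q²≤n³⇒q²≤n³ : ∀ d q n .{{_ : NonZero d}} → 2 * d * d * (q * q) ≤ n ^ 3 → q * q ≤ n ^ 3
  2d²q²≤n³⇒q²≤n³ d q n = ≤-trans (m≤n*m (q * q) (2 * d * d) {{m*n≢0 (2 * d) d {{m*n≢0 2 d}}}})

  module _ {N N′ P R q : ℕ} .{{_ : NonZero q}} (q≡P+R : q ≡ P + R) (N≤1+N′ : N ≤ suc N′)
           (bound : N′ * N * N * (R * R) ≤ P * (q * q * q)) where

    private instance
      q²≢0 : NonZero (q * q)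
      q²≢0 = m*n≢0 q q

    q≤8P⊎N³≤8Pq : (0 < N → 0 < P) → q ≤ 8 * P * 1 ⊎ N ^ 3 ≤ 8 * P * q
    q≤8P⊎N³≤8Pq 0<P with R ≤? P
    ... | yes R≤P = inj₁ (begin
      q          ≡⟨ q≡P+R ⟩
      P + R      ≤⟨ +-monoʳ-≤ P R≤P ⟩
      P + P      ≤⟨ m≤m+n (P + P) (6 * P) ⟩
      P + P + 6 * P ≡⟨ eight P ⟩
      8 * P * 1  ∎)
      where
      open ≤-Reasoning
      eight : ∀ P → P + P + 6 * P ≡ 8 * P * 1
      eight = solve-∀
    ... | no R≰P = inj₂ (subst (N ^ 3 ≤_) (regroup P q) (n′n²≤m⇒n³≤2m N≤1+N′ 0<4Pq N′N²≤4Pq))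
      where
      open ≤-Reasoning
      0<4Pq : 0 < N → 0 < 4 * P * q
      0<4Pq 0<N = *-mono-< (*-monoʳ-< 4 (0<P 0<N)) (>-nonZero⁻¹ q)
      q≤R+R : q ≤ R + R
      q≤R+R = subst (_≤ R + R) (sym q≡P+R) (+-monoˡ-≤ R (<⇒≤ (≰⇒> R≰P)))
      N′N²≤4Pq : N′ * N * N ≤ 4 * P * q
      N′N²≤4Pq = *-cancelʳ-≤ _ _ (q * q) (begin
        N′ * N * N * (q * q)             ≤⟨ *-monoʳ-≤ (N′ * N * N) (*-mono-≤ q≤R+R q≤R+R) ⟩
        N′ * N * N * ((R + R) * (R + R)) ≡⟨ expand (N′ * N * N) R ⟩
        4 * (N′ * N * N * (R * R))       ≤⟨ *-monoʳ-≤ 4 bound ⟩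
        4 * (P * (q * q * q))            ≡⟨ collect P q ⟩
        4 * P * q * (q * q)              ∎)
        where
        expand : ∀ X R → X * ((R + R) * (R + R)) ≡ 4 * (X * (R * R))
        expand = solve-∀
        collect : ∀ P q → 4 * (P * (q * q * q)) ≡ 4 * P * q * (q * q)
        collect = solve-∀
      regroup : ∀ P q → 2 * (4 * P * q) ≡ 8 * P * q
      regroup = solve-∀

    2d²q²≤N³⇒dR≤q : ∀ d .{{_ : NonZero d}} → 2 * d * d * (q * q) ≤ N ^ 3 → d * R ≤ q
    2d²q²≤N³⇒dR≤q d big = m*m≤n*n⇒m≤n (*-cancelʳ-≤ _ _ (q * q) (begin
      d * R * (d * R) * (q * q)  ≡⟨ regroup d R q ⟩
      d * d * (q * q) * (R * R)  ≤⟨ *-monoˡ-≤ (R * R) d²q²≤N′N² ⟩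
      N′ * N * N * (R * R)       ≤⟨ bound ⟩
      P * (q * q * q)            ≤⟨ *-monoˡ-≤ (q * q * q) P≤q ⟩
      q * (q * q * q)            ≡⟨ square q ⟩
      q * q * (q * q)            ∎))
      where
      open ≤-Reasoning
      instance
        d²q²≢0 : NonZero (d * d * (q * q))
        d²q²≢0 = m*n≢0 (d * d) (q * q) {{m*n≢0 d d}}
      regroup : ∀ d R q → d * R * (d * R) * (q * q) ≡ d * d * (q * q) * (R * R)
      regroup = solve-∀
      square : ∀ q → q * (q * q * q) ≡ q * q * (q * q)
      square = solve-∀
      P≤q : P ≤ q
      P≤q = subst (P ≤_) (sym q≡P+R) (m≤m+n P R)
      reassoc : ∀ d q → 2 * d * d * (q * q) ≡ 2 * (d * d * (q * q))
      reassoc = solve-∀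
      big′ : 2 * (d * d * (q * q)) ≤ N ^ 3
      big′ = subst (_≤ N ^ 3) (reassoc d q) big
      2≤N : 2 ≤ N
      2≤N = 2≤n³⇒2≤n N (≤-trans (m≤m*n 2 (d * d * (q * q))) big′)
      d²q²≤N′N² : d * d * (q * q) ≤ N′ * N * N
      d²q²≤N′N² = *-cancelˡ-≤ 2 (≤-trans big′ (n³≤2n′n² 2≤N N≤1+N′))

module RationalBounds where

  open import Data.Nat as ℕ using (ℕ; suc)
  import Data.Nat.Properties as ℕ
  import Data.Nat.Tactic.RingSolver as ℕ-Solver
  open import Data.Integer as ℤ using (ℤ; +_; +[1+_]; -[1+_]; +≤+)
  import Data.Integer.Properties as ℤ
  open import Data.Integer.Tactic.RingSolver using (solve-∀)
  open import Data.Rational using (mkℚ; _/_; -_; _*_; _-_; _≤_; _<_; 0ℚ; 1ℚ; toℚᵘ; ↧ₙ_; *<*)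
  open import Data.Rational.Properties
    using (toℚᵘ-cancel-≤; toℚᵘ-homo-*; toℚᵘ-homo-+; toℚᵘ-homo‿-; toℚᵘ-fromℚᵘ)
  open import Data.Rational.Unnormalised as ℚᵘ using (mkℚᵘ; *≤*)
  import Data.Rational.Unnormalised.Properties as ℚᵘ
  open import Relation.Binary.PropositionalEquality

  toℚᵘ-/ : ∀ i d → toℚᵘ (i / suc d) ℚᵘ.≃ mkℚᵘ i d
  toℚᵘ-/ i d = toℚᵘ-fromℚᵘ (mkℚᵘ i d)

  fraction-≤ : ∀ a b m n → a ℕ.* suc n ℕ.≤ b ℕ.* suc m → + a / suc m ≤ + b / suc n
  fraction-≤ a b m n le = toℚᵘ-cancel-≤ (begin
    toℚᵘ (+ a / suc m) ≃⟨ toℚᵘ-/ (+ a) m ⟩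
    mkℚᵘ (+ a) m       ≤⟨ *≤* (subst₂ ℤ._≤_ (ℤ.pos-* a (suc n)) (ℤ.pos-* b (suc m)) (+≤+ le)) ⟩
    mkℚᵘ (+ b) n       ≃⟨ toℚᵘ-/ (+ b) n ⟨
    toℚᵘ (+ b / suc n) ∎)
    where open ℚᵘ.≤-Reasoning

  eighth-≤ : ∀ a d P → a ℕ.≤ 8 ℕ.* P ℕ.* suc d → (+ 1 / 8) * (+ a / suc d) ≤ + P / 1
  eighth-≤ a d P le = toℚᵘ-cancel-≤ (begin
    toℚᵘ ((+ 1 / 8) * (+ a / suc d))      ≃⟨ toℚᵘ-homo-* (+ 1 / 8) (+ a / suc d) ⟩
    toℚᵘ (+ 1 / 8) ℚᵘ.* toℚᵘ (+ a / suc d) ≃⟨ ℚᵘ.*-cong (toℚᵘ-/ (+ 1) 7) (toℚᵘ-/ (+ a) d) ⟩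
    mkℚᵘ (+ 1) 7 ℚᵘ.* mkℚᵘ (+ a) d        ≤⟨ *≤* cross ⟩
    mkℚᵘ (+ P) 0                          ≃⟨ toℚᵘ-/ (+ P) 0 ⟨
    toℚᵘ (+ P / 1)                        ∎)
    where
    open ℚᵘ.≤-Reasoning
    cross : (+ 1 ℤ.* + a) ℤ.* + 1 ℤ.≤ + P ℤ.* + (8 ℕ.* suc d)
    cross = subst₂ ℤ._≤_ (sym (trans (ℤ.*-identityʳ _) (ℤ.*-identityˡ (+ a)))) (ℤ.pos-* P (8 ℕ.* suc d))
                   (+≤+ (subst (a ℕ.≤_) (regroup P (suc d)) le))
      where
      regroup : ∀ P d → 8 ℕ.* P ℕ.* d ≡ P ℕ.* (8 ℕ.* d)
      regroup = ℕ-Solver.solve-∀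

  one-minus-ε-≤ : ∀ ε P R → 0ℚ < ε → ↧ₙ ε ℕ.* R ℕ.≤ P ℕ.+ R → (1ℚ - ε) * (+ (P ℕ.+ R) / 1) ≤ + P / 1
  one-minus-ε-≤ ε@(mkℚ +[1+ u-1 ] d-1 _) P R _ dR≤q = toℚᵘ-cancel-≤ (begin
    toℚᵘ ((1ℚ - ε) * (+ q / 1))                        ≃⟨ toℚᵘ-homo-* (1ℚ - ε) (+ q / 1) ⟩
    toℚᵘ (1ℚ - ε) ℚᵘ.* toℚᵘ (+ q / 1)                  ≃⟨ ℚᵘ.*-cong 1-ε≃ (toℚᵘ-/ (+ q) 0) ⟩
    (mkℚᵘ (+ 1) 0 ℚᵘ.+ ℚᵘ.- mkℚᵘ (+ u) d-1) ℚᵘ.* mkℚᵘ (+ q) 0 ≤⟨ *≤* cross ⟩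
    mkℚᵘ (+ P) 0                                       ≃⟨ toℚᵘ-/ (+ P) 0 ⟨
    toℚᵘ (+ P / 1)                                     ∎)
    where
    open ℚᵘ.≤-Reasoning
    q = P ℕ.+ R
    d = suc d-1
    u = suc u-1
    1-ε≃ : toℚᵘ (1ℚ - ε) ℚᵘ.≃ mkℚᵘ (+ 1) 0 ℚᵘ.+ ℚᵘ.- mkℚᵘ (+ u) d-1
    1-ε≃ = ℚᵘ.≃-trans (toℚᵘ-homo-+ 1ℚ (- ε)) (ℚᵘ.+-cong (toℚᵘ-/ (+ 1) 0) (toℚᵘ-homo‿- ε))
    dR≤uq : + d ℤ.* + R ℤ.≤ + u ℤ.* + q
    dR≤uq = subst₂ ℤ._≤_ (ℤ.pos-* d R) (ℤ.pos-* u q) (+≤+ (ℕ.≤-trans dR≤q (ℕ.m≤n*m q u)))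
    cross : (+ 1 ℤ.* + d ℤ.+ ℤ.- + u ℤ.* + 1) ℤ.* + q ℤ.* + 1 ℤ.≤ + P ℤ.* + (1 ℕ.* d ℕ.* 1)
    cross = subst₂ ℤ._≤_ (sym expand) (cong (λ n → + P ℤ.* + n) (sym (trans (ℕ.*-identityʳ _) (ℕ.*-identityˡ d))))
      (ℤ.≤-trans (ℤ.+-monoʳ-≤ (+ P ℤ.* + d) (ℤ.i≤j⇒i-j≤0 dR≤uq)) (ℤ.≤-reflexive (ℤ.+-identityʳ _)))
      where
      regroup : ∀ P R d u → (+ 1 ℤ.* d ℤ.+ ℤ.- u ℤ.* + 1) ℤ.* (P ℤ.+ R) ℤ.* + 1
                            ≡ P ℤ.* d ℤ.+ (d ℤ.* R ℤ.- u ℤ.* (P ℤ.+ R))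
      regroup = solve-∀
      expand : (+ 1 ℤ.* + d ℤ.+ ℤ.- + u ℤ.* + 1) ℤ.* + q ℤ.* + 1
               ≡ + P ℤ.* + d ℤ.+ (+ d ℤ.* + R ℤ.- + u ℤ.* + q)
      expand = subst (λ z → (+ 1 ℤ.* + d ℤ.+ ℤ.- + u ℤ.* + 1) ℤ.* z ℤ.* + 1
                            ≡ + P ℤ.* + d ℤ.+ (+ d ℤ.* + R ℤ.- + u ℤ.* z))
                     (sym (ℤ.pos-+ P R)) (regroup (+ P) (+ R) (+ d) (+ u))
  one-minus-ε-≤ (mkℚ (+ 0)    _ _) _ _ (*<* (ℤ.+<+ ())) _
  one-minus-ε-≤ (mkℚ -[1+ _ ] _ _) _ _ (*<* ())          _


module Bounds {q′ : ℕ} (Q : Quasifield (suc q′)) (A : Subset (suc q′)) where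

  open import Data.Nat as ℕ using (_∸_; _^_)
  open import Data.Nat.Properties using (m+[n∸m]≡n; *-identityʳ)
  open import Data.Fin.Subset using (∣_∣)
  open import Data.Fin.Subset.Properties using (∣p∣≤n)
  open import Data.Integer using (+_)
  open import Data.Rational using (_/_; _*_; _-_; _≤_; _<_; 0ℚ; 1ℚ; ↧ₙ_)
  open import Data.Rational.Properties
    using (≤-trans; *-monoˡ-≤-nonNeg; p⊓q≤p; p⊓q≤q; p≤q⇒p⊓q≡p; module ≤-Reasoning)
  open import Data.Sum using ([_,_]′)
  open import Relation.Binary.PropositionalEquality using (_≡_; cong; sym; subst)
  open Quasifield Q using (𝟘)
  open ProductSumSet Q A using (P; prodSumSet-bound; prodSumSet-nonempty)
  open SubsetProperties using (∣p∣≤1+∣p-x∣)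
  open Arithmetic using (q≤8P⊎N³≤8Pq; 2d²q²≤N³⇒dR≤q; 2d²q²≤n³⇒q²≤n³)
  open RationalBounds using (fraction-≤; eighth-≤; one-minus-ε-≤)

  q R : ℕ
  q = suc q′
  R = q ∸ ∣ P ∣

  q≡P+R : q ≡ ∣ P ∣ ℕ.+ R
  q≡P+R = sym (m+[n∸m]≡n (∣p∣≤n P))

  eighth-min-bound : (+ 1 / 8) * minBound Q ∣ A ∣ ≤ + ∣ P ∣ / 1
  eighth-min-bound =
    [ (λ q≤8P → ≤-trans (*-monoˡ-≤-nonNeg (+ 1 / 8) (p⊓q≤p (+ q / 1) (+ (∣ A ∣ ^ 3) / q)))
                        (eighth-≤ q 0 ∣ P ∣ q≤8P))
    , (λ N³≤8Pq → ≤-trans (*-monoˡ-≤-nonNeg (+ 1 / 8) (p⊓q≤q (+ q / 1) (+ (∣ A ∣ ^ 3) / q)))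
                          (eighth-≤ (∣ A ∣ ^ 3) q′ ∣ P ∣ N³≤8Pq))
    ]′ (q≤8P⊎N³≤8Pq q≡P+R (∣p∣≤1+∣p-x∣ A 𝟘) prodSumSet-bound prodSumSet-nonempty)

  large-min-bound : ∀ ε → 0ℚ < ε → 2 ℕ.* ↧ₙ ε ℕ.* ↧ₙ ε ℕ.* q ^ 2 ℕ.≤ ∣ A ∣ ^ 3 →
                    (1ℚ - ε) * minBound Q ∣ A ∣ ≤ + ∣ P ∣ / 1
  large-min-bound ε 0<ε big = begin
    (1ℚ - ε) * minBound Q ∣ A ∣        ≡⟨ cong ((1ℚ - ε) *_) min≡q ⟩
    (1ℚ - ε) * (+ q / 1)               ≡⟨ cong (λ n → (1ℚ - ε) * (+ n / 1)) q≡P+R ⟩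
    (1ℚ - ε) * (+ (∣ P ∣ ℕ.+ R) / 1)   ≤⟨ one-minus-ε-≤ ε ∣ P ∣ R 0<ε dR≤P+R ⟩
    + ∣ P ∣ / 1                        ∎
    where
    open ≤-Reasoning
    big′ : 2 ℕ.* ↧ₙ ε ℕ.* ↧ₙ ε ℕ.* (q ℕ.* q) ℕ.≤ ∣ A ∣ ^ 3
    big′ = subst (λ x → 2 ℕ.* ↧ₙ ε ℕ.* ↧ₙ ε ℕ.* x ℕ.≤ ∣ A ∣ ^ 3) (cong (q ℕ.*_) (*-identityʳ q)) big
    dR≤P+R : ↧ₙ ε ℕ.* R ℕ.≤ ∣ P ∣ ℕ.+ R
    dR≤P+R = subst (ℕ._≤_ (↧ₙ ε ℕ.* R)) q≡P+R
                   (2d²q²≤N³⇒dR≤q q≡P+R (∣p∣≤1+∣p-x∣ A 𝟘) prodSumSet-bound (↧ₙ ε) big′)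
    min≡q : minBound Q ∣ A ∣ ≡ + q / 1
    min≡q = p≤q⇒p⊓q≡p (fraction-≤ q (∣ A ∣ ^ 3) 0 q′
                         (subst (ℕ._≤_ (q ℕ.* q)) (sym (*-identityʳ _)) (2d²q²≤n³⇒q²≤n³ (↧ₙ ε) q ∣ A ∣ big′)))

open import Data.Nat using (ℕ; _≥_; _^_) renaming (_*_ to _*ℕ_)
open import Data.Fin.Subset using (Subset; ∣_∣)
open import Data.Integer using (+_)
open import Data.Rational using (ℚ; _/_; _*_; _-_; _≤_; _<_; 0ℚ; 1ℚ)
open import Data.Product using (Σ; _×_)

open import Data.Nat using (zero; z≤n; s≤s)
open import Data.Fin.Properties using (¬Fin0)
open import Data.Empty using (⊥-elim)
open import Data.Integer using (+<+)
open import Data.Product using (_,_)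
open import Data.Rational using (↧ₙ_; *<*)

corollary1p7 :
    (Σ ℚ λ c → (0ℚ < c) ×
      (∀ (q : ℕ) (Q : Quasifield q) (A : Subset q) →
        c * minBound Q ∣ A ∣ ≤ (+ ∣ prodSumSet Q A ∣ / 1)))
    ×
    (∀ (ε : ℚ) → 0ℚ < ε →
      Σ ℕ λ K → Σ ℕ λ N →
        ∀ (q : ℕ) (Q : Quasifield q) (A : Subset q) →
          q ≥ N → ∣ A ∣ ^ 3 ≥ K *ℕ (q ^ 2) →
          (1ℚ - ε) * minBound Q ∣ A ∣ ≤ (+ ∣ prodSumSet Q A ∣ / 1))
-- K = 2 d² for d = ↧ₙ ε, which satisfies ε ≥ 1 / d.
corollary1p7 =
  (+ 1 / 8 , *<* (+<+ (s≤s z≤n)) , eighth) ,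
  λ ε 0<ε → 2 *ℕ ↧ₙ ε *ℕ ↧ₙ ε , 0 , λ q Q A _ → large ε 0<ε q Q A
  where
  eighth : ∀ q (Q : Quasifield q) (A : Subset q) → (+ 1 / 8) * minBound Q ∣ A ∣ ≤ + ∣ prodSumSet Q A ∣ / 1
  eighth zero    Q _ = ⊥-elim (¬Fin0 (Quasifield.𝟘 Q))
  eighth (suc _) Q A = Bounds.eighth-min-bound Q A
  large : ∀ ε → 0ℚ < ε → ∀ q (Q : Quasifield q) (A : Subset q) →
          ∣ A ∣ ^ 3 ≥ 2 *ℕ ↧ₙ ε *ℕ ↧ₙ ε *ℕ (q ^ 2) → (1ℚ - ε) * minBound Q ∣ A ∣ ≤ + ∣ prodSumSet Q A ∣ / 1
  large _ _   zero    Q _ = ⊥-elim (¬Fin0 (Quasifield.𝟘 Q))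
  large ε 0<ε (suc _) Q A = Bounds.large-min-bound Q A ε 0<ε
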